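{- Let $n\geq1$, let $\overline{\Gamma}_n$ be the cube-complement of $\Gamma_n$, and let $B_n$ be the set of edges of $Q_n$ having exactly one endpoint which is a Fibonacci string. Then: (i) $|E(Q_n)|=|E(\overline{\Gamma}_n)|+|B_n|+|E(\Gamma_n)|$, and this equals the total number of $0$'s in all binary strings of length $n$; (ii) $|B_n|+|E(\Gamma_n)|$ is the total number of $0$'s in all Fibonacci strings of length $n$; (iii) $|B_n|+|E(\overline{\Gamma}_n)|$ is the total number of $1$'s in all non-Fibonacci strings of length $n$; (iv) $|E(\overline{\Gamma}_n)|$ is the total number of $0$'s in all non-Fibonacci strings of length $n$; (v) $|E(\Gamma_n)|$ is the total number of $1$'s in all Fibonacci strings of length $n$.
   Context: The hypercube $Q_n$ has vertex set the binary strings of length $n$, adjacency meaning differing in exactly one position. A Fibonacci string is a binary string with no two consecutive 1's; a non-Fibonacci string is a binary string containing $11$ as a substring. $\Gamma_n$ is the subgraph of $Q_n$ induced by Fibonacci strings of length $n$, and its cube-complement $\overline{\Gamma}_n$ is the subgraph of $Q_n$ induced by the non-Fibonacci strings of length $n$. "The total number of $0$'s in a set $S$ of strings" means $\sum_{s\in S}|\{i: s_i=0\}|$, and similarly for $1$'s. -}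

module Defs where

open import Data.Bool using (Bool; true; false; not; _∧_; _∨_)
open import Data.Nat using (ℕ; zero; suc; _+_)
open import Data.List using (List; []; _∷_; map; concatMap; filterᵇ; length; _++_)
open import Data.Nat.ListAction using (sum)
open import Data.Vec using (Vec; []; _∷_)
open import Data.Product using (_×_; _,_; proj₁; proj₂)

-- Binary strings of length n (true = 1, false = 0).
BStr : ℕ → Set
BStr n = Vec Bool n

allStrings : (n : ℕ) → List (BStr n)
allStrings zero = [] ∷ []
allStrings (suc n) = map (false ∷_) (allStrings n) ++ map (true ∷_) (allStrings n)

hamming : ∀ {n} → BStr n → BStr n → ℕ
hamming [] [] = 0
hamming (a ∷ u) (b ∷ v) = (if-diff a b) + hamming u v
  where
  if-diff : Bool → Bool → ℕ
  if-diff true false = 1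
  if-diff false true = 1
  if-diff _ _ = 0

adjᵇ : ∀ {n} → BStr n → BStr n → Bool
adjᵇ u v with hamming u v
... | 1 = true
... | _ = false

-- strict lexicographic order (false < true), used to count each
-- unordered edge {u,v} exactly once
lexLtᵇ : ∀ {n} → BStr n → BStr n → Bool
lexLtᵇ [] [] = false
lexLtᵇ (false ∷ u) (true ∷ v) = true
lexLtᵇ (true ∷ u) (false ∷ v) = false
lexLtᵇ (false ∷ u) (false ∷ v) = lexLtᵇ u v
lexLtᵇ (true ∷ u) (true ∷ v) = lexLtᵇ u v

has11 : ∀ {n} → BStr n → Bool
has11 [] = false
has11 (true ∷ true ∷ v) = true
has11 (_ ∷ v) = has11 v

isFib : ∀ {n} → BStr n → Bool
isFib v = not (has11 v)

isNonFib : ∀ {n} → BStr n → Bool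
isNonFib v = has11 v

fibStrings : (n : ℕ) → List (BStr n)
fibStrings n = filterᵇ isFib (allStrings n)

nonFibStrings : (n : ℕ) → List (BStr n)
nonFibStrings n = filterᵇ isNonFib (allStrings n)

pairsOf : ∀ {A : Set} → List A → List A → List (A × A)
pairsOf xs ys = concatMap (λ x → map (x ,_) ys) xs

-- Edge set of Q_n: unordered pairs {u,v} of adjacent strings,
-- each listed once (as (u,v) with u <lex v).
edgesQ : (n : ℕ) → List (BStr n × BStr n)
edgesQ n = filterᵇ (λ p → adjᵇ (proj₁ p) (proj₂ p) ∧ lexLtᵇ (proj₁ p) (proj₂ p))
                   (pairsOf (allStrings n) (allStrings n))

edgesΓ : (n : ℕ) → List (BStr n × BStr n)
edgesΓ n = filterᵇ (λ p → isFib (proj₁ p) ∧ isFib (proj₂ p)) (edgesQ n)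

edgesΓbar : (n : ℕ) → List (BStr n × BStr n)
edgesΓbar n = filterᵇ (λ p → isNonFib (proj₁ p) ∧ isNonFib (proj₂ p)) (edgesQ n)

xorᵇ : Bool → Bool → Bool
xorᵇ a b = (a ∧ not b) ∨ (not a ∧ b)

edgesB : (n : ℕ) → List (BStr n × BStr n)
edgesB n = filterᵇ (λ p → xorᵇ (isFib (proj₁ p)) (isFib (proj₂ p))) (edgesQ n)

zeros : ∀ {n} → BStr n → ℕ
zeros [] = 0
zeros (false ∷ v) = suc (zeros v)
zeros (true ∷ v) = zeros v

ones : ∀ {n} → BStr n → ℕ
ones [] = 0
ones (true ∷ v) = suc (ones v)
ones (false ∷ v) = ones v

totalZeros : ∀ {n} → List (BStr n) → ℕ
totalZeros S = sum (map zeros S)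

totalOnes : ∀ {n} → List (BStr n) → ℕ
totalOnes S = sum (map ones S)

-- Orient every edge of Q_n from the string with a 0 at the differing position (lower end)
-- to the one with a 1 there (upper end). A string u is the lower end of exactly as many
-- edges as it has 0's, and the upper end of exactly as many edges as it has 1's. Containing
-- 11 is preserved by turning 0's into 1's, so an edge of the cube-complement is determined
-- by its lower end being non-Fibonacci, and an edge of Γ_n by its upper end being Fibonacci;
-- this gives (iv) and (v). The three classes partition the edges of Q_n, whose number is
-- the total number of 0's, and also of 1's, in all strings; subtracting (iv) and (v) from
-- the totals over Fibonacci plus non-Fibonacci strings gives (ii) and (iii).
module Submission where

open import Defs
open import Data.Nat using (ℕ; zero; suc; _+_; _*_; _≥_; _≡ᵇ_)
open import Data.Nat.Properties
  using (+-comm; +-assoc; +-identityʳ; *-zeroʳ; *-distribˡ-+; +-cancelˡ-≡; +-cancelʳ-≡;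
         +-commutativeSemigroup)
open import Algebra.Properties.CommutativeSemigroup +-commutativeSemigroup using (interchange)
open import Data.Bool using (Bool; true; false; not; _∧_; T; _≤_; b≤b; f≤t)
open import Data.Bool.Properties using (∧-identityʳ; ∧-zeroʳ; T-∧)
open import Data.Empty using (⊥-elim)
open import Data.Unit using (tt)
open import Data.List using (List; []; _∷_; length; map; filterᵇ; _++_)
open import Data.List.Properties using (map-++; map-∘; map-cong)
open import Data.Nat.ListAction using (sum)
open import Data.Nat.ListAction.Properties using (sum-++)
open import Data.Vec using ([]; _∷_)
open import Data.Vec.Relation.Binary.Pointwise.Inductive as Pointwise using (Pointwise; []; _∷_)
open import Data.Product using (_×_; _,_; proj₁; proj₂)
open import Function using (_∘_; Equivalence)
open import Relation.Binary.PropositionalEquality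
  using (_≡_; refl; sym; trans; cong; cong₂; module ≡-Reasoning)

open ≡-Reasoning

𝟙 : Bool → ℕ
𝟙 true = 1
𝟙 false = 0

𝟙-∧ : ∀ a b → 𝟙 (a ∧ b) ≡ 𝟙 a * 𝟙 b
𝟙-∧ true b = sym (+-identityʳ (𝟙 b))
𝟙-∧ false b = refl

𝟙-*+𝟙-not-* : ∀ a n → 𝟙 a * n + 𝟙 (not a) * n ≡ n
𝟙-*+𝟙-not-* true n = trans (+-identityʳ (n + 0)) (+-identityʳ n)
𝟙-*+𝟙-not-* false n = +-identityʳ n

∑ : {A : Set} → List A → (A → ℕ) → ℕ
∑ xs f = sum (map f xs)

syntax ∑ xs (λ x → e) = ∑[ x ∈ xs ] e

private variable
  A B : Set

∑-cong : (xs : List A) {f g : A → ℕ} → (∀ x → f x ≡ g x) → ∑ xs f ≡ ∑ xs g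
∑-cong xs f≗g = cong sum (map-cong f≗g xs)

∑-++ : (xs ys : List A) (f : A → ℕ) → ∑ (xs ++ ys) f ≡ ∑ xs f + ∑ ys f
∑-++ xs ys f = trans (cong sum (map-++ f xs ys)) (sum-++ (map f xs) (map f ys))

∑-map : (g : A → B) (xs : List A) (f : B → ℕ) → ∑ (map g xs) f ≡ ∑ xs (f ∘ g)
∑-map g xs f = cong sum (sym (map-∘ xs))

∑-const-1 : (xs : List A) → ∑[ _ ∈ xs ] 1 ≡ length xs
∑-const-1 [] = refl
∑-const-1 (_ ∷ xs) = cong suc (∑-const-1 xs)

∑-zero : (xs : List A) → ∑[ _ ∈ xs ] 0 ≡ 0
∑-zero [] = refl
∑-zero (_ ∷ xs) = ∑-zero xs

∑-∧-true : (p : A → Bool) (xs : List A) → ∑[ x ∈ xs ] 𝟙 (p x ∧ true) ≡ ∑[ x ∈ xs ] 𝟙 (p x)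
∑-∧-true p xs = ∑-cong xs (λ x → cong 𝟙 (∧-identityʳ (p x)))

∑-∧-false : (p : A → Bool) (xs : List A) → ∑[ x ∈ xs ] 𝟙 (p x ∧ false) ≡ 0
∑-∧-false p xs = trans (∑-cong xs (λ x → cong 𝟙 (∧-zeroʳ (p x)))) (∑-zero xs)

∑-+ : (xs : List A) (f g : A → ℕ) → ∑[ x ∈ xs ] (f x + g x) ≡ ∑ xs f + ∑ xs g
∑-+ [] f g = refl
∑-+ (x ∷ xs) f g =
  trans (cong (f x + g x +_) (∑-+ xs f g)) (interchange (f x) (g x) (∑ xs f) (∑ xs g))

∑-*ˡ : (xs : List A) (k : ℕ) (f : A → ℕ) → ∑[ x ∈ xs ] (k * f x) ≡ k * ∑ xs f
∑-*ˡ [] k f = sym (*-zeroʳ k)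
∑-*ˡ (x ∷ xs) k f =
  trans (cong (k * f x +_) (∑-*ˡ xs k f)) (sym (*-distribˡ-+ k (f x) (∑ xs f)))

∑-swap : (xs : List A) (ys : List B) (f : A → B → ℕ) →
         ∑[ x ∈ xs ] ∑[ y ∈ ys ] f x y ≡ ∑[ y ∈ ys ] ∑[ x ∈ xs ] f x y
∑-swap [] ys f = sym (∑-zero ys)
∑-swap (x ∷ xs) ys f =
  trans (cong (∑ ys (f x) +_) (∑-swap xs ys f)) (sym (∑-+ ys (f x) _))

∑-pairsOf : (xs ys : List A) (f : A × A → ℕ) →
            ∑ (pairsOf xs ys) f ≡ ∑[ x ∈ xs ] ∑[ y ∈ ys ] f (x , y)
∑-pairsOf [] ys f = refl
∑-pairsOf (x ∷ xs) ys f =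
  trans (∑-++ (map (x ,_) ys) _ f) (cong₂ _+_ (∑-map (x ,_) ys f) (∑-pairsOf xs ys f))

∑-filterᵇ : (p : A → Bool) (xs : List A) (f : A → ℕ) →
            ∑ (filterᵇ p xs) f ≡ ∑[ x ∈ xs ] (𝟙 (p x) * f x)
∑-filterᵇ p [] f = refl
∑-filterᵇ p (x ∷ xs) f with p x
... | true = cong₂ _+_ (sym (+-identityʳ (f x))) (∑-filterᵇ p xs f)
... | false = ∑-filterᵇ p xs f

∑-filterᵇ+∑-filterᵇ-not : (p : A → Bool) (xs : List A) (f : A → ℕ) →
                          ∑ (filterᵇ p xs) f + ∑ (filterᵇ (not ∘ p) xs) f ≡ ∑ xs f
∑-filterᵇ+∑-filterᵇ-not p xs f = begin
  ∑ (filterᵇ p xs) f + ∑ (filterᵇ (not ∘ p) xs) f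
    ≡⟨ cong₂ _+_ (∑-filterᵇ p xs f) (∑-filterᵇ (not ∘ p) xs f) ⟩
  ∑[ x ∈ xs ] (𝟙 (p x) * f x) + ∑[ x ∈ xs ] (𝟙 (not (p x)) * f x)
    ≡⟨ sym (∑-+ xs _ _) ⟩
  ∑[ x ∈ xs ] (𝟙 (p x) * f x + 𝟙 (not (p x)) * f x)
    ≡⟨ ∑-cong xs (λ x → 𝟙-*+𝟙-not-* (p x) (f x)) ⟩
  ∑ xs f ∎

length-filterᵇ : (p : A → Bool) (xs : List A) → length (filterᵇ p xs) ≡ ∑[ x ∈ xs ] 𝟙 (p x)
length-filterᵇ p [] = refl
length-filterᵇ p (x ∷ xs) with p x
... | true = cong suc (length-filterᵇ p xs)
... | false = length-filterᵇ p xs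

length-filterᵇ-filterᵇ : (p q : A → Bool) (xs : List A) →
                         length (filterᵇ q (filterᵇ p xs)) ≡ ∑[ x ∈ xs ] 𝟙 (p x ∧ q x)
length-filterᵇ-filterᵇ p q xs = begin
  length (filterᵇ q (filterᵇ p xs))    ≡⟨ length-filterᵇ q (filterᵇ p xs) ⟩
  ∑[ x ∈ filterᵇ p xs ] 𝟙 (q x)        ≡⟨ ∑-filterᵇ p xs (𝟙 ∘ q) ⟩
  ∑[ x ∈ xs ] (𝟙 (p x) * 𝟙 (q x))      ≡⟨ ∑-cong xs (λ x → sym (𝟙-∧ (p x) (q x))) ⟩
  ∑[ x ∈ xs ] 𝟙 (p x ∧ q x)            ∎

length-filterᵇ-partition : (p q r : A → Bool) (xs : List A) →
                           (∀ x → 𝟙 (p x) + 𝟙 (q x) + 𝟙 (r x) ≡ 1) →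
                           length (filterᵇ p xs) + length (filterᵇ q xs) + length (filterᵇ r xs)
                             ≡ length xs
length-filterᵇ-partition p q r xs exactly-one = begin
  length (filterᵇ p xs) + length (filterᵇ q xs) + length (filterᵇ r xs)
    ≡⟨ cong₂ _+_ (cong₂ _+_ (length-filterᵇ p xs) (length-filterᵇ q xs)) (length-filterᵇ r xs) ⟩
  ∑[ x ∈ xs ] 𝟙 (p x) + ∑[ x ∈ xs ] 𝟙 (q x) + ∑[ x ∈ xs ] 𝟙 (r x)
    ≡⟨ cong (_+ ∑[ x ∈ xs ] 𝟙 (r x)) (sym (∑-+ xs (𝟙 ∘ p) (𝟙 ∘ q))) ⟩
  ∑[ x ∈ xs ] (𝟙 (p x) + 𝟙 (q x)) + ∑[ x ∈ xs ] 𝟙 (r x)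
    ≡⟨ sym (∑-+ xs _ (𝟙 ∘ r)) ⟩
  ∑[ x ∈ xs ] (𝟙 (p x) + 𝟙 (q x) + 𝟙 (r x))
    ≡⟨ ∑-cong xs exactly-one ⟩
  ∑[ _ ∈ xs ] 1
    ≡⟨ ∑-const-1 xs ⟩
  length xs ∎

∑-allStrings-suc : ∀ n (f : BStr (suc n) → ℕ) →
                   ∑ (allStrings (suc n)) f
                     ≡ ∑[ v ∈ allStrings n ] f (false ∷ v) + ∑[ v ∈ allStrings n ] f (true ∷ v)
∑-allStrings-suc n f =
  trans (∑-++ (map (false ∷_) (allStrings n)) _ f)
        (cong₂ _+_ (∑-map (false ∷_) (allStrings n) f) (∑-map (true ∷_) (allStrings n) f))

hamming-comm : ∀ {n} (u v : BStr n) → hamming u v ≡ hamming v u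
hamming-comm [] [] = refl
hamming-comm (false ∷ u) (false ∷ v) = hamming-comm u v
hamming-comm (false ∷ u) (true ∷ v) = cong suc (hamming-comm u v)
hamming-comm (true ∷ u) (false ∷ v) = cong suc (hamming-comm u v)
hamming-comm (true ∷ u) (true ∷ v) = hamming-comm u v

hamming≡0⇒≡ : ∀ {n} (u v : BStr n) → T (hamming u v ≡ᵇ 0) → u ≡ v
hamming≡0⇒≡ [] [] _ = refl
hamming≡0⇒≡ (false ∷ u) (false ∷ v) h = cong (false ∷_) (hamming≡0⇒≡ u v h)
hamming≡0⇒≡ (true ∷ u) (true ∷ v) h = cong (true ∷_) (hamming≡0⇒≡ u v h)

∑-hamming≡0 : ∀ {n} (u : BStr n) → ∑[ v ∈ allStrings n ] 𝟙 (hamming u v ≡ᵇ 0) ≡ 1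
∑-hamming≡0 [] = refl
∑-hamming≡0 {suc n} (false ∷ u)
  rewrite ∑-allStrings-suc n (λ v → 𝟙 (hamming (false ∷ u) v ≡ᵇ 0))
        | ∑-hamming≡0 u | ∑-zero (allStrings n) = refl
∑-hamming≡0 {suc n} (true ∷ u)
  rewrite ∑-allStrings-suc n (λ v → 𝟙 (hamming (true ∷ u) v ≡ᵇ 0))
        | ∑-hamming≡0 u | ∑-zero (allStrings n) = refl

∑-hamming≡0ˡ : ∀ {n} (v : BStr n) → ∑[ u ∈ allStrings n ] 𝟙 (hamming u v ≡ᵇ 0) ≡ 1
∑-hamming≡0ˡ {n} v =
  trans (∑-cong (allStrings n) (λ u → cong (λ d → 𝟙 (d ≡ᵇ 0)) (hamming-comm u v)))
        (∑-hamming≡0 v)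

-- Adjacent with u before v in lexicographic order: v is u with one 0 turned into a 1.
_⋖ᵇ_ : ∀ {n} → BStr n → BStr n → Bool
u ⋖ᵇ v = (hamming u v ≡ᵇ 1) ∧ lexLtᵇ u v

adjᵇ≡hamming≡1 : ∀ {n} (u v : BStr n) → adjᵇ u v ≡ (hamming u v ≡ᵇ 1)
adjᵇ≡hamming≡1 u v with hamming u v
... | zero = refl
... | suc zero = refl
... | suc (suc _) = refl

count-above≡zeros : ∀ {n} (u : BStr n) → ∑[ v ∈ allStrings n ] 𝟙 (u ⋖ᵇ v) ≡ zeros u
count-above≡zeros [] = refl
count-above≡zeros {suc n} (false ∷ u) = begin
  ∑[ v ∈ allStrings (suc n) ] 𝟙 ((false ∷ u) ⋖ᵇ v)
    ≡⟨ ∑-allStrings-suc n _ ⟩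
  ∑[ v ∈ allStrings n ] 𝟙 (u ⋖ᵇ v) + ∑[ v ∈ allStrings n ] 𝟙 ((hamming u v ≡ᵇ 0) ∧ true)
    ≡⟨ cong₂ _+_ (count-above≡zeros u)
                 (trans (∑-∧-true (λ v → hamming u v ≡ᵇ 0) (allStrings n)) (∑-hamming≡0 u)) ⟩
  zeros u + 1
    ≡⟨ +-comm (zeros u) 1 ⟩
  suc (zeros u) ∎
count-above≡zeros {suc n} (true ∷ u) = begin
  ∑[ v ∈ allStrings (suc n) ] 𝟙 ((true ∷ u) ⋖ᵇ v)
    ≡⟨ ∑-allStrings-suc n _ ⟩
  ∑[ v ∈ allStrings n ] 𝟙 ((hamming u v ≡ᵇ 0) ∧ false) + ∑[ v ∈ allStrings n ] 𝟙 (u ⋖ᵇ v)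
    ≡⟨ cong₂ _+_ (∑-∧-false (λ v → hamming u v ≡ᵇ 0) (allStrings n)) (count-above≡zeros u) ⟩
  zeros u ∎

count-below≡ones : ∀ {n} (v : BStr n) → ∑[ u ∈ allStrings n ] 𝟙 (u ⋖ᵇ v) ≡ ones v
count-below≡ones [] = refl
count-below≡ones {suc n} (false ∷ v) = begin
  ∑[ u ∈ allStrings (suc n) ] 𝟙 (u ⋖ᵇ (false ∷ v))
    ≡⟨ ∑-allStrings-suc n _ ⟩
  ∑[ u ∈ allStrings n ] 𝟙 (u ⋖ᵇ v) + ∑[ u ∈ allStrings n ] 𝟙 ((hamming u v ≡ᵇ 0) ∧ false)
    ≡⟨ cong₂ _+_ (count-below≡ones v) (∑-∧-false (λ u → hamming u v ≡ᵇ 0) (allStrings n)) ⟩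
  ones v + 0
    ≡⟨ +-identityʳ (ones v) ⟩
  ones v ∎
count-below≡ones {suc n} (true ∷ v) = begin
  ∑[ u ∈ allStrings (suc n) ] 𝟙 (u ⋖ᵇ (true ∷ v))
    ≡⟨ ∑-allStrings-suc n _ ⟩
  ∑[ u ∈ allStrings n ] 𝟙 ((hamming u v ≡ᵇ 0) ∧ true) + ∑[ u ∈ allStrings n ] 𝟙 (u ⋖ᵇ v)
    ≡⟨ cong₂ _+_ (trans (∑-∧-true (λ u → hamming u v ≡ᵇ 0) (allStrings n)) (∑-hamming≡0ˡ v))
                 (count-below≡ones v) ⟩
  suc (ones v) ∎

⋖ᵇ⇒≤ : ∀ {n} (u v : BStr n) → T (u ⋖ᵇ v) → Pointwise _≤_ u v
⋖ᵇ⇒≤ [] [] ()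
⋖ᵇ⇒≤ (false ∷ u) (false ∷ v) h = b≤b ∷ ⋖ᵇ⇒≤ u v h
⋖ᵇ⇒≤ (true ∷ u) (true ∷ v) h = b≤b ∷ ⋖ᵇ⇒≤ u v h
⋖ᵇ⇒≤ (false ∷ u) (true ∷ v) h
  rewrite hamming≡0⇒≡ u v (proj₁ (Equivalence.to T-∧ h)) = f≤t ∷ Pointwise.refl b≤b
⋖ᵇ⇒≤ (true ∷ u) (false ∷ v) h = ⊥-elim (proj₂ (Equivalence.to T-∧ h))

has11-∷ : ∀ {n} b (v : BStr n) → T (has11 v) → T (has11 (b ∷ v))
has11-∷ false v h = h
has11-∷ true (false ∷ v) h = h
has11-∷ true (true ∷ v) _ = tt

has11-mono : ∀ {n} {u v : BStr n} → Pointwise _≤_ u v → T (has11 u) → T (has11 v)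
has11-mono {u = true ∷ true ∷ _} (b≤b ∷ b≤b ∷ _) h = h
has11-mono {u = true ∷ false ∷ _} {_ ∷ v} (b≤b ∷ u≤v) h = has11-∷ true v (has11-mono u≤v h)
has11-mono {u = false ∷ _} {b ∷ v} (_ ∷ u≤v) h = has11-∷ b v (has11-mono u≤v h)

⋖ᵇ-has11 : ∀ {n} (u v : BStr n) → T (u ⋖ᵇ v) → T (has11 u) → T (has11 v)
⋖ᵇ-has11 u v = has11-mono ∘ ⋖ᵇ⇒≤ u v

∑²-cong : ∀ n {f g : BStr n → BStr n → ℕ} → (∀ u v → f u v ≡ g u v) →
          ∑[ u ∈ allStrings n ] ∑[ v ∈ allStrings n ] f u v
            ≡ ∑[ u ∈ allStrings n ] ∑[ v ∈ allStrings n ] g u v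
∑²-cong n f≗g = ∑-cong (allStrings n) (λ u → ∑-cong (allStrings n) (f≗g u))

length-edgesQ : ∀ n →
                length (edgesQ n) ≡ ∑[ u ∈ allStrings n ] ∑[ v ∈ allStrings n ] 𝟙 (u ⋖ᵇ v)
length-edgesQ n =
  trans (length-filterᵇ _ (pairsOf (allStrings n) (allStrings n)))
        (trans (∑-pairsOf (allStrings n) (allStrings n) _)
               (∑²-cong n (λ u v → cong (λ a → 𝟙 (a ∧ lexLtᵇ u v)) (adjᵇ≡hamming≡1 u v))))

length-filterᵇ-edgesQ : ∀ n (Q : BStr n × BStr n → Bool) →
                        length (filterᵇ Q (edgesQ n))
                          ≡ ∑[ u ∈ allStrings n ] ∑[ v ∈ allStrings n ] 𝟙 (u ⋖ᵇ v ∧ Q (u , v))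
length-filterᵇ-edgesQ n Q =
  trans (length-filterᵇ-filterᵇ _ Q (pairsOf (allStrings n) (allStrings n)))
        (trans (∑-pairsOf (allStrings n) (allStrings n) _)
               (∑²-cong n λ u v →
                  cong (λ a → 𝟙 ((a ∧ lexLtᵇ u v) ∧ Q (u , v))) (adjᵇ≡hamming≡1 u v)))

length-edgesQ≡totalZeros : ∀ n → length (edgesQ n) ≡ totalZeros (allStrings n)
length-edgesQ≡totalZeros n = trans (length-edgesQ n) (∑-cong (allStrings n) count-above≡zeros)

length-edgesQ≡totalOnes : ∀ n → length (edgesQ n) ≡ totalOnes (allStrings n)
length-edgesQ≡totalOnes n =
  trans (length-edgesQ n)
        (trans (∑-swap (allStrings n) (allStrings n) _) (∑-cong (allStrings n) count-below≡ones))

length-edges-by-lower : ∀ n (Q : BStr n × BStr n → Bool) (P : BStr n → Bool) →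
                        (∀ u v → (u ⋖ᵇ v ∧ Q (u , v)) ≡ (P u ∧ u ⋖ᵇ v)) →
                        length (filterᵇ Q (edgesQ n)) ≡ totalZeros (filterᵇ P (allStrings n))
length-edges-by-lower n Q P Q≡P = begin
  length (filterᵇ Q (edgesQ n))
    ≡⟨ length-filterᵇ-edgesQ n Q ⟩
  ∑[ u ∈ allStrings n ] ∑[ v ∈ allStrings n ] 𝟙 (u ⋖ᵇ v ∧ Q (u , v))
    ≡⟨ ∑²-cong n (λ u v → cong 𝟙 (Q≡P u v)) ⟩
  ∑[ u ∈ allStrings n ] ∑[ v ∈ allStrings n ] 𝟙 (P u ∧ u ⋖ᵇ v)
    ≡⟨ ∑-cong (allStrings n) row ⟩
  ∑[ u ∈ allStrings n ] (𝟙 (P u) * zeros u)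
    ≡⟨ sym (∑-filterᵇ P (allStrings n) zeros) ⟩
  totalZeros (filterᵇ P (allStrings n)) ∎
  where
  row : ∀ u → ∑[ v ∈ allStrings n ] 𝟙 (P u ∧ u ⋖ᵇ v) ≡ 𝟙 (P u) * zeros u
  row u = trans (∑-cong (allStrings n) (λ v → 𝟙-∧ (P u) (u ⋖ᵇ v)))
                (trans (∑-*ˡ (allStrings n) (𝟙 (P u)) _)
                       (cong (𝟙 (P u) *_) (count-above≡zeros u)))

length-edges-by-upper : ∀ n (Q : BStr n × BStr n → Bool) (P : BStr n → Bool) →
                        (∀ u v → (u ⋖ᵇ v ∧ Q (u , v)) ≡ (P v ∧ u ⋖ᵇ v)) →
                        length (filterᵇ Q (edgesQ n)) ≡ totalOnes (filterᵇ P (allStrings n))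
length-edges-by-upper n Q P Q≡P = begin
  length (filterᵇ Q (edgesQ n))
    ≡⟨ length-filterᵇ-edgesQ n Q ⟩
  ∑[ u ∈ allStrings n ] ∑[ v ∈ allStrings n ] 𝟙 (u ⋖ᵇ v ∧ Q (u , v))
    ≡⟨ ∑²-cong n (λ u v → cong 𝟙 (Q≡P u v)) ⟩
  ∑[ u ∈ allStrings n ] ∑[ v ∈ allStrings n ] 𝟙 (P v ∧ u ⋖ᵇ v)
    ≡⟨ ∑-swap (allStrings n) (allStrings n) _ ⟩
  ∑[ v ∈ allStrings n ] ∑[ u ∈ allStrings n ] 𝟙 (P v ∧ u ⋖ᵇ v)
    ≡⟨ ∑-cong (allStrings n) column ⟩
  ∑[ v ∈ allStrings n ] (𝟙 (P v) * ones v)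
    ≡⟨ sym (∑-filterᵇ P (allStrings n) ones) ⟩
  totalOnes (filterᵇ P (allStrings n)) ∎
  where
  column : ∀ v → ∑[ u ∈ allStrings n ] 𝟙 (P v ∧ u ⋖ᵇ v) ≡ 𝟙 (P v) * ones v
  column v = trans (∑-cong (allStrings n) (λ u → 𝟙-∧ (P v) (u ⋖ᵇ v)))
                   (trans (∑-*ˡ (allStrings n) (𝟙 (P v)) _)
                          (cong (𝟙 (P v) *_) (count-below≡ones v)))

𝟙-trichotomy : ∀ a b → 𝟙 (a ∧ b) + 𝟙 (xorᵇ (not a) (not b)) + 𝟙 (not a ∧ not b) ≡ 1
𝟙-trichotomy true true = refl
𝟙-trichotomy true false = refl
𝟙-trichotomy false true = refl
𝟙-trichotomy false false = refl

upward-∧ : ∀ c a b → (T c → T a → T b) → (c ∧ (a ∧ b)) ≡ (a ∧ c)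
upward-∧ false a b _ = sym (∧-zeroʳ a)
upward-∧ true false b _ = refl
upward-∧ true true true _ = refl
upward-∧ true true false up = ⊥-elim (up tt tt)

upward-not-∧ : ∀ c a b → (T c → T a → T b) → (c ∧ (not a ∧ not b)) ≡ (not b ∧ c)
upward-not-∧ false a b _ = sym (∧-zeroʳ (not b))
upward-not-∧ true false b _ = sym (∧-identityʳ (not b))
upward-not-∧ true true true _ = refl
upward-not-∧ true true false up = ⊥-elim (up tt tt)

length-edgesΓbar≡totalZeros : ∀ n → length (edgesΓbar n) ≡ totalZeros (nonFibStrings n)
length-edgesΓbar≡totalZeros n =
  length-edges-by-lower n _ isNonFib (λ u v → upward-∧ (u ⋖ᵇ v) _ _ (⋖ᵇ-has11 u v))

length-edgesΓ≡totalOnes : ∀ n → length (edgesΓ n) ≡ totalOnes (fibStrings n)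
length-edgesΓ≡totalOnes n =
  length-edges-by-upper n _ isFib (λ u v → upward-not-∧ (u ⋖ᵇ v) _ _ (⋖ᵇ-has11 u v))

length-edgesQ≡Γbar+B+Γ : ∀ n → length (edgesQ n)
                                   ≡ length (edgesΓbar n) + length (edgesB n) + length (edgesΓ n)
length-edgesQ≡Γbar+B+Γ n =
  sym (length-filterᵇ-partition _ _ _ (edgesQ n)
         (λ e → 𝟙-trichotomy (has11 (proj₁ e)) (has11 (proj₂ e))))

mainTheorem13 : (n : ℕ) → n ≥ 1 →
    (length (edgesQ n) ≡ length (edgesΓbar n) + length (edgesB n) + length (edgesΓ n)
    × length (edgesQ n) ≡ totalZeros (allStrings n))
    × (length (edgesB n) + length (edgesΓ n) ≡ totalZeros (fibStrings n))
    × (length (edgesB n) + length (edgesΓbar n) ≡ totalOnes (nonFibStrings n))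
    × (length (edgesΓbar n) ≡ totalZeros (nonFibStrings n))
    × (length (edgesΓ n) ≡ totalOnes (fibStrings n))
mainTheorem13 n _ =
  (partition , length-edgesQ≡totalZeros n) , lowerFib , upperNonFib , Γ̄ , Γ
  where
  #Q #Γ̄ #B #Γ : ℕ
  #Q = length (edgesQ n)
  #Γ̄ = length (edgesΓbar n)
  #B = length (edgesB n)
  #Γ = length (edgesΓ n)

  partition : #Q ≡ #Γ̄ + #B + #Γ
  partition = length-edgesQ≡Γbar+B+Γ n

  Γ̄ : #Γ̄ ≡ totalZeros (nonFibStrings n)
  Γ̄ = length-edgesΓbar≡totalZeros n

  Γ : #Γ ≡ totalOnes (fibStrings n)
  Γ = length-edgesΓ≡totalOnes n

  lowerFib : #B + #Γ ≡ totalZeros (fibStrings n)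
  lowerFib = +-cancelˡ-≡ #Γ̄ _ _ (begin
    #Γ̄ + (#B + #Γ)                ≡⟨ sym (+-assoc #Γ̄ #B #Γ) ⟩
    #Γ̄ + #B + #Γ                  ≡⟨ sym partition ⟩
    #Q                            ≡⟨ length-edgesQ≡totalZeros n ⟩
    totalZeros (allStrings n)     ≡⟨ sym (∑-filterᵇ+∑-filterᵇ-not isNonFib (allStrings n) zeros) ⟩
    totalZeros (nonFibStrings n) + totalZeros (fibStrings n)
                                  ≡⟨ cong (_+ totalZeros (fibStrings n)) (sym Γ̄) ⟩
    #Γ̄ + totalZeros (fibStrings n) ∎)

  upperNonFib : #B + #Γ̄ ≡ totalOnes (nonFibStrings n)
  upperNonFib = +-cancelʳ-≡ #Γ _ _ (begin
    #B + #Γ̄ + #Γ                  ≡⟨ cong (_+ #Γ) (+-comm #B #Γ̄) ⟩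
    #Γ̄ + #B + #Γ                  ≡⟨ sym partition ⟩
    #Q                            ≡⟨ length-edgesQ≡totalOnes n ⟩
    totalOnes (allStrings n)      ≡⟨ sym (∑-filterᵇ+∑-filterᵇ-not isNonFib (allStrings n) ones) ⟩
    totalOnes (nonFibStrings n) + totalOnes (fibStrings n)
                                  ≡⟨ cong (totalOnes (nonFibStrings n) +_) (sym Γ) ⟩
    totalOnes (nonFibStrings n) + #Γ ∎)
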